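{- The cut rule is admissible in $\mathsf{GWFDI}$: for all finite multisets $\Gamma,\Gamma'$ of formulas and all formulas $D,E$, if $\Gamma\Rightarrow D$ and $D,\Gamma'\Rightarrow E$ are derivable in $\mathsf{GWFDI}$, then $\Gamma,\Gamma'\Rightarrow E$ is derivable in $\mathsf{GWFDI}$.
   Context: Formulas are built from a countable set of propositional atoms and $\bot$ using $\wedge,\vee,\rightarrow$. Sequents of $\mathsf{GWFDI}$ have the form $\Gamma\Rightarrow C$ with $\Gamma$ a finite multiset of formulas and $C$ a formula. Rules ($p$ atomic): (Ax) $p,\Gamma\Rightarrow p$; ($\bot_L$) $\bot,\Gamma\Rightarrow C$; ($\wedge_L$) from $A,B,\Gamma\Rightarrow C$ infer $A\wedge B,\Gamma\Rightarrow C$; ($\wedge_R$) from $\Gamma\Rightarrow A$ and $\Gamma\Rightarrow B$ infer $\Gamma\Rightarrow A\wedge B$; ($\vee_L$) from $A,\Gamma\Rightarrow C$ and $B,\Gamma\Rightarrow C$ infer $A\vee B,\Gamma\Rightarrow C$; ($\vee_R^1$) from $\Gamma\Rightarrow A$ infer $\Gamma\Rightarrow A\vee B$; ($\vee_R^2$) from $\Gamma\Rightarrow B$ infer $\Gamma\Rightarrow A\vee B$; ($\rightarrow_R$) from $A\Rightarrow B$ infer $\Gamma\Rightarrow A\rightarrow B$; ($\rightarrow_{LR}$) from $A\Rightarrow B$, $B\Rightarrow A$, $C\Rightarrow D$, $D\Rightarrow C$ infer $\Gamma,A\rightarrow C\Rightarrow B\rightarrow D$; ($\rightarrow_I$) from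 $\Gamma\Rightarrow B\rightarrow C$ and $\Gamma\Rightarrow C\rightarrow D$ infer $\Gamma\Rightarrow B\rightarrow D$; ($\rightarrow_D$) from $\Gamma\Rightarrow B\rightarrow C$ and $\Gamma\Rightarrow D\rightarrow C$ infer $\Gamma\Rightarrow B\vee D\rightarrow C$. Derivability uses only these rules, without cut. -}

module Defs where

open import Data.Nat using (ℕ)
open import Data.List using (List; []; _∷_; [_]; _++_)
open import Data.List.Relation.Binary.Permutation.Propositional using (_↭_)

data Formula : Set where
  atom : ℕ → Formula
  ⊥'   : Formula
  _∧'_ : Formula → Formula → Formula
  _∨'_ : Formula → Formula → Formula
  _⇒'_ : Formula → Formula → Formula

infixr 6 _∧'_
infixr 5 _∨'_
infixr 4 _⇒'_

-- Finite multisets of formulas are represented by lists; two lists denote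
-- the same multiset iff they are permutations of each other (_↭_).
Ctx : Set
Ctx = List Formula

-- A rule whose conclusion has the shape
-- "A , Γ ⇒ C" applies to any list Δ that is a permutation of A ∷ Γ, so that
-- derivability respects the multiset reading of antecedents.
infix 3 _⊢_
data _⊢_ : Ctx → Formula → Set where
  Ax   : ∀ {Δ Γ} n → Δ ↭ (atom n ∷ Γ) → Δ ⊢ atom n
  ⊥L   : ∀ {Δ Γ C} → Δ ↭ (⊥' ∷ Γ) → Δ ⊢ C
  ∧L   : ∀ {Δ Γ A B C} → Δ ↭ ((A ∧' B) ∷ Γ) →
         (A ∷ B ∷ Γ) ⊢ C → Δ ⊢ C
  ∧R   : ∀ {Γ A B} → Γ ⊢ A → Γ ⊢ B → Γ ⊢ A ∧' B
  ∨L   : ∀ {Δ Γ A B C} → Δ ↭ ((A ∨' B) ∷ Γ) →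
         (A ∷ Γ) ⊢ C → (B ∷ Γ) ⊢ C → Δ ⊢ C
  ∨R₁  : ∀ {Γ A B} → Γ ⊢ A → Γ ⊢ A ∨' B
  ∨R₂  : ∀ {Γ A B} → Γ ⊢ B → Γ ⊢ A ∨' B
  ⇒R   : ∀ {Γ A B} → [ A ] ⊢ B → Γ ⊢ A ⇒' B
  ⇒LR  : ∀ {Δ Γ A B C D} → Δ ↭ ((A ⇒' C) ∷ Γ) →
         [ A ] ⊢ B → [ B ] ⊢ A → [ C ] ⊢ D → [ D ] ⊢ C →
         Δ ⊢ B ⇒' D
  ⇒I   : ∀ {Γ B C D} → Γ ⊢ B ⇒' C → Γ ⊢ C ⇒' D → Γ ⊢ B ⇒' D
  ⇒D   : ∀ {Γ B C D} → Γ ⊢ B ⇒' C → Γ ⊢ D ⇒' C → Γ ⊢ (B ∨' D) ⇒' C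

{-# OPTIONS --safe #-}
-- Cut is proved in the context-sharing form  Γ ⊢ D , D ∷ Γ ⊢ E ⟹ Γ ⊢ E
-- (the stated form follows by weakening), by induction on D and then on the
-- derivation of D ∷ Γ ⊢ E.  All left rules are invertible, so when D is not
-- principal in the last rule the derivation of Γ ⊢ D is inverted to fit the
-- premises.  When D is principal, ∧ reduces to cuts on its components, and
-- so does ∨ after an induction on the derivation of Γ ⊢ A ∨ B (∨R is not
-- invertible, but left rules commute with the cut); a derivation of Γ ⊢ ⊥
-- only uses left rules and ends in ⊥L.  Implications need no induction at
-- all: the premises of ⇒LR are one-formula sequents, and ⇒I is itself a cut
-- on implications.
module Submission where

open import Data.List using ([]; _∷_; [_]; _++_)
open import Data.List.Membership.Propositional using (_∈_)
open import Data.List.Membership.Propositional.Properties using (∈-∃++)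
open import Data.List.Relation.Binary.Permutation.Propositional
  using (_↭_; ↭-refl; ↭-sym; ↭-trans; ↭-prep; ↭-swap)
open import Data.List.Relation.Binary.Permutation.Propositional.Properties
  using (∈-resp-↭; ++⁺ˡ; shift; shifts; drop-∷; ++-comm)
open import Data.List.Relation.Unary.Any using (here; there)
open import Data.Product using (_×_; _,_; ∃; map; zip)
open import Data.Unit using (⊤; tt)
open import Relation.Binary.PropositionalEquality using (_≡_; refl)

open import Defs

private
  infixr 5 _⟫_
  _⟫_ : ∀ {xs ys zs : Ctx} → xs ↭ ys → ys ↭ zs → xs ↭ zs
  _⟫_ = ↭-trans

exchange : ∀ {Δ Δ′ C} → Δ ↭ Δ′ → Δ ⊢ C → Δ′ ⊢ C
exchange q (Ax n p)         = Ax n (↭-sym q ⟫ p)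
exchange q (⊥L p)           = ⊥L (↭-sym q ⟫ p)
exchange q (∧L p d)         = ∧L (↭-sym q ⟫ p) d
exchange q (∧R d e)         = ∧R (exchange q d) (exchange q e)
exchange q (∨L p d e)       = ∨L (↭-sym q ⟫ p) d e
exchange q (∨R₁ d)          = ∨R₁ (exchange q d)
exchange q (∨R₂ d)          = ∨R₂ (exchange q d)
exchange q (⇒R d)           = ⇒R d
exchange q (⇒LR p a b c d)  = ⇒LR (↭-sym q ⟫ p) a b c d
exchange q (⇒I d e)         = ⇒I (exchange q d) (exchange q e)
exchange q (⇒D d e)         = ⇒D (exchange q d) (exchange q e)

focus-++ : ∀ (xs : Ctx) {Γ Γ′ X} → Γ ↭ X ∷ Γ′ → xs ++ Γ ↭ X ∷ xs ++ Γ′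
focus-++ xs {Γ′ = Γ′} {X} p = ++⁺ˡ xs p ⟫ shift X xs Γ′

weaken : ∀ {Γ C} X → Γ ⊢ C → X ∷ Γ ⊢ C
weaken X (Ax n p)         = Ax n (focus-++ [ X ] p)
weaken X (⊥L p)           = ⊥L (focus-++ [ X ] p)
weaken X (∧L {A = A} {B} p d) =
  ∧L (focus-++ [ X ] p) (exchange (shifts [ X ] (A ∷ B ∷ [])) (weaken X d))
weaken X (∧R d e)         = ∧R (weaken X d) (weaken X e)
weaken X (∨L {A = A} {B} p d e) =
  ∨L (focus-++ [ X ] p) (exchange (shifts [ X ] [ A ]) (weaken X d))
                        (exchange (shifts [ X ] [ B ]) (weaken X e))
weaken X (∨R₁ d)          = ∨R₁ (weaken X d)
weaken X (∨R₂ d)          = ∨R₂ (weaken X d)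
weaken X (⇒R d)           = ⇒R d
weaken X (⇒LR p a b c d)  = ⇒LR (focus-++ [ X ] p) a b c d
weaken X (⇒I d e)         = ⇒I (weaken X d) (weaken X e)
weaken X (⇒D d e)         = ⇒D (weaken X d) (weaken X e)

weaken-++ : ∀ (Γ′ : Ctx) {Γ C} → Γ ⊢ C → Γ′ ++ Γ ⊢ C
weaken-++ []       d = d
weaken-++ (X ∷ Γ′) d = weaken X (weaken-++ Γ′ d)

∈⇒focus : ∀ {P : Formula} {Γ} → P ∈ Γ → ∃ λ Γ′ → Γ ↭ P ∷ Γ′
∈⇒focus {P} P∈Γ with ∈-∃++ P∈Γ
... | xs , ys , refl = xs ++ ys , shift P xs ys

data Foci (P D : Formula) (Γ₁ Γ : Ctx) : Set where
  same  : P ≡ D → Γ₁ ↭ Γ → Foci P D Γ₁ Γ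
  apart : ∀ Γ₂ → Γ ↭ P ∷ Γ₂ → Γ₁ ↭ D ∷ Γ₂ → Foci P D Γ₁ Γ

compare-foci : ∀ {Δ P D Γ₁ Γ} → Δ ↭ P ∷ Γ₁ → Δ ↭ D ∷ Γ → Foci P D Γ₁ Γ
compare-foci {P = P} {D} p q with ∈-resp-↭ (↭-sym p ⟫ q) (here refl)
... | here refl = same refl (drop-∷ (↭-sym p ⟫ q))
... | there P∈Γ with ∈⇒focus P∈Γ
...   | Γ₂ , r  = apart Γ₂ r (drop-∷ (↭-sym p ⟫ q ⟫ ↭-prep D r ⟫ ↭-swap D P ↭-refl))

∧L-inv : ∀ {Δ Γ A B E} → Δ ⊢ E → Δ ↭ (A ∧' B) ∷ Γ → A ∷ B ∷ Γ ⊢ E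
∧L-inv {A = A} {B} (Ax n p) q with compare-foci p q
... | same () _
... | apart _ r _ = Ax n (focus-++ (A ∷ B ∷ []) r)
∧L-inv {A = A} {B} (⊥L p) q with compare-foci p q
... | same () _
... | apart _ r _ = ⊥L (focus-++ (A ∷ B ∷ []) r)
∧L-inv {A = A} {B} (∧L {A = A′} {B′} p d) q with compare-foci p q
... | same refl s = exchange (++⁺ˡ (A ∷ B ∷ []) s) d
... | apart _ r s =
  ∧L (focus-++ (A ∷ B ∷ []) r)
     (exchange (shifts (A ∷ B ∷ []) (A′ ∷ B′ ∷ [])) (∧L-inv d (focus-++ (A′ ∷ B′ ∷ []) s)))
∧L-inv {A = A} {B} (∨L {A = A′} {B′} p d e) q with compare-foci p q
... | same () _
... | apart _ r s =
  ∨L (focus-++ (A ∷ B ∷ []) r)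
     (exchange (shifts (A ∷ B ∷ []) [ A′ ]) (∧L-inv d (focus-++ [ A′ ] s)))
     (exchange (shifts (A ∷ B ∷ []) [ B′ ]) (∧L-inv e (focus-++ [ B′ ] s)))
∧L-inv {A = A} {B} (⇒LR p a b c d) q with compare-foci p q
... | same () _
... | apart _ r _ = ⇒LR (focus-++ (A ∷ B ∷ []) r) a b c d
∧L-inv (∧R d e) q = ∧R (∧L-inv d q) (∧L-inv e q)
∧L-inv (∨R₁ d)  q = ∨R₁ (∧L-inv d q)
∧L-inv (∨R₂ d)  q = ∨R₂ (∧L-inv d q)
∧L-inv (⇒R d)   q = ⇒R d
∧L-inv (⇒I d e) q = ⇒I (∧L-inv d q) (∧L-inv e q)
∧L-inv (⇒D d e) q = ⇒D (∧L-inv d q) (∧L-inv e q)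

∨L-inv : ∀ {Δ Γ A B E} → Δ ⊢ E → Δ ↭ (A ∨' B) ∷ Γ → (A ∷ Γ ⊢ E) × (B ∷ Γ ⊢ E)
∨L-inv {A = A} {B} (Ax n p) q with compare-foci p q
... | same () _
... | apart _ r _ = Ax n (focus-++ [ A ] r) , Ax n (focus-++ [ B ] r)
∨L-inv {A = A} {B} (⊥L p) q with compare-foci p q
... | same () _
... | apart _ r _ = ⊥L (focus-++ [ A ] r) , ⊥L (focus-++ [ B ] r)
∨L-inv {A = A} {B} (∧L {A = A′} {B′} p d) q with compare-foci p q
... | same () _
... | apart _ r s with ∨L-inv d (focus-++ (A′ ∷ B′ ∷ []) s)
...   | dA , dB = ∧L (focus-++ [ A ] r) (exchange (shifts [ A ] (A′ ∷ B′ ∷ [])) dA)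
                , ∧L (focus-++ [ B ] r) (exchange (shifts [ B ] (A′ ∷ B′ ∷ [])) dB)
∨L-inv {A = A} {B} (∨L {A = A′} {B′} p d e) q with compare-foci p q
... | same refl s = exchange (↭-prep A s) d , exchange (↭-prep B s) e
... | apart _ r s with ∨L-inv d (focus-++ [ A′ ] s) | ∨L-inv e (focus-++ [ B′ ] s)
...   | dA , dB | eA , eB =
    ∨L (focus-++ [ A ] r) (exchange (shifts [ A ] [ A′ ]) dA) (exchange (shifts [ A ] [ B′ ]) eA)
  , ∨L (focus-++ [ B ] r) (exchange (shifts [ B ] [ A′ ]) dB) (exchange (shifts [ B ] [ B′ ]) eB)
∨L-inv {A = A} {B} (⇒LR p a b c d) q with compare-foci p q
... | same () _
... | apart _ r _ = ⇒LR (focus-++ [ A ] r) a b c d , ⇒LR (focus-++ [ B ] r) a b c d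
∨L-inv (∧R d e) q = zip ∧R ∧R (∨L-inv d q) (∨L-inv e q)
∨L-inv (∨R₁ d)  q = map ∨R₁ ∨R₁ (∨L-inv d q)
∨L-inv (∨R₂ d)  q = map ∨R₂ ∨R₂ (∨L-inv d q)
∨L-inv (⇒R d)   q = ⇒R d , ⇒R d
∨L-inv (⇒I d e) q = zip ⇒I ⇒I (∨L-inv d q) (∨L-inv e q)
∨L-inv (⇒D d e) q = zip ⇒D ⇒D (∨L-inv d q) (∨L-inv e q)

∧R-inv : ∀ {Γ A B} → Γ ⊢ A ∧' B → (Γ ⊢ A) × (Γ ⊢ B)
∧R-inv (⊥L p)     = ⊥L p , ⊥L p
∧R-inv (∧L p d)   = map (∧L p) (∧L p) (∧R-inv d)
∧R-inv (∨L p d e) = zip (∨L p) (∨L p) (∧R-inv d) (∧R-inv e)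
∧R-inv (∧R d e)   = d , e

⊢⊥-elim : ∀ {Γ E} → Γ ⊢ ⊥' → Γ ⊢ E
⊢⊥-elim (⊥L p)     = ⊥L p
⊢⊥-elim (∧L p d)   = ∧L p (⊢⊥-elim d)
⊢⊥-elim (∨L p d e) = ∨L p (⊢⊥-elim d) (⊢⊥-elim e)

Cut : Formula → Set
Cut D = ∀ {Γ E} → Γ ⊢ D → D ∷ Γ ⊢ E → Γ ⊢ E

ComponentCuts : Formula → Set
ComponentCuts (A ∧' B) = Cut A × Cut B
ComponentCuts (A ∨' B) = Cut A × Cut B
ComponentCuts _        = ⊤

∧-cut : ∀ {A B Γ E} → Cut A × Cut B → Γ ⊢ A ∧' B → A ∷ B ∷ Γ ⊢ E → Γ ⊢ E
∧-cut {A} {B} (cut-A , cut-B) L R with ∧R-inv L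
... | LA , LB = cut-A LA (cut-B (weaken A LB) (exchange (↭-swap A B ↭-refl) R))

∨-cut : ∀ {A B Γ E} → Cut A × Cut B → Γ ⊢ A ∨' B → A ∷ Γ ⊢ E → B ∷ Γ ⊢ E → Γ ⊢ E
∨-cut cuts (⊥L p) RA RB = ⊥L p
∨-cut {A} {B} cuts (∧L {A = A′} {B′} p d) RA RB =
  ∧L p (∨-cut cuts d (exchange (shifts (A′ ∷ B′ ∷ []) [ A ]) (∧L-inv RA (focus-++ [ A ] p)))
                     (exchange (shifts (A′ ∷ B′ ∷ []) [ B ]) (∧L-inv RB (focus-++ [ B ] p))))
∨-cut {A} {B} cuts (∨L {A = A′} {B′} p d e) RA RB
  with ∨L-inv RA (focus-++ [ A ] p) | ∨L-inv RB (focus-++ [ B ] p)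
... | RA-A′ , RA-B′ | RB-A′ , RB-B′ =
  ∨L p (∨-cut cuts d (exchange (shifts [ A′ ] [ A ]) RA-A′) (exchange (shifts [ A′ ] [ B ]) RB-A′))
       (∨-cut cuts e (exchange (shifts [ B′ ] [ A ]) RA-B′) (exchange (shifts [ B′ ] [ B ]) RB-B′))
∨-cut (cut-A , _) (∨R₁ d) RA RB = cut-A d RA
∨-cut (_ , cut-B) (∨R₂ d) RA RB = cut-B d RB

⇒-cut : ∀ {Γ A B C D} → Γ ⊢ A ⇒' C → [ B ] ⊢ A → [ C ] ⊢ D → Γ ⊢ B ⇒' D
⇒-cut L B⊢A C⊢D = ⇒I (⇒I (⇒R B⊢A) L) (⇒R C⊢D)

cut-↭ : ∀ {D Γ Δ E} → ComponentCuts D → Γ ⊢ D → Δ ⊢ E → Δ ↭ D ∷ Γ → Γ ⊢ E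
cut-↭ cuts L (Ax n p) q with compare-foci p q
... | same refl _ = L
... | apart _ r _ = Ax n r
cut-↭ cuts L (⊥L p) q with compare-foci p q
... | same refl _ = ⊢⊥-elim L
... | apart _ r _ = ⊥L r
cut-↭ cuts L (∧L {A = A} {B} p d) q with compare-foci p q
... | same refl s = ∧-cut cuts L (exchange (++⁺ˡ (A ∷ B ∷ []) s) d)
... | apart _ r s = ∧L r (cut-↭ cuts (∧L-inv L r) d (focus-++ (A ∷ B ∷ []) s))
cut-↭ cuts L (∨L {A = A} {B} p d e) q with compare-foci p q
... | same refl s = ∨-cut cuts L (exchange (↭-prep A s) d) (exchange (↭-prep B s) e)
... | apart _ r s with ∨L-inv L r
...   | LA , LB = ∨L r (cut-↭ cuts LA d (focus-++ [ A ] s))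
                       (cut-↭ cuts LB e (focus-++ [ B ] s))
cut-↭ cuts L (⇒LR p a b c d) q with compare-foci p q
... | same refl _ = ⇒-cut L b c
... | apart _ r _ = ⇒LR r a b c d
cut-↭ cuts L (∧R d e) q = ∧R (cut-↭ cuts L d q) (cut-↭ cuts L e q)
cut-↭ cuts L (∨R₁ d)  q = ∨R₁ (cut-↭ cuts L d q)
cut-↭ cuts L (∨R₂ d)  q = ∨R₂ (cut-↭ cuts L d q)
cut-↭ cuts L (⇒R d)   q = ⇒R d
cut-↭ cuts L (⇒I d e) q = ⇒I (cut-↭ cuts L d q) (cut-↭ cuts L e q)
cut-↭ cuts L (⇒D d e) q = ⇒D (cut-↭ cuts L d q) (cut-↭ cuts L e q)

cut : ∀ D → Cut D
component-cuts : ∀ D → ComponentCuts D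

cut D L R = cut-↭ (component-cuts D) L R ↭-refl

component-cuts (atom _) = tt
component-cuts ⊥'       = tt
component-cuts (A ∧' B) = cut A , cut B
component-cuts (A ∨' B) = cut A , cut B
component-cuts (A ⇒' B) = tt

mainTheorem19 : ∀ (Γ Γ′ : Ctx) (D E : Formula) →
    Γ ⊢ D → (D ∷ Γ′) ⊢ E → (Γ ++ Γ′) ⊢ E
mainTheorem19 Γ Γ′ D E L R =
  cut D (exchange (++-comm Γ′ Γ) (weaken-++ Γ′ L)) (exchange (shift D Γ Γ′) (weaken-++ Γ R))
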